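{- Let $d<n$ and $$C_1=\begin{pmatrix}A_1&A_2\\ \mathbf 0&I_{n-d}\end{pmatrix},\qquad D_1=\begin{pmatrix}B_1&B_2\\ \mathbf 0&I_{n-d}\end{pmatrix},$$ where $A_1,B_1$ are $d\times d$ integer matrices and $A_2,B_2$ are arbitrary integer matrices of size $d\times(n-d)$. Then $A_1\simeq_{\mathrm{UP}}B_1$ if and only if $C_1\simeq_{\mathrm{UP}}D_1$.
   Context: For $\sigma\in\mathfrak S_k$, $P_\sigma=(\mathbf e_{\sigma(1)}|\cdots|\mathbf e_{\sigma(k)})$. For $M,M'\in\mathbb Z^{m\times k}$, $M\simeq_{\mathrm{UP}}M'$ (unimodular permutation equivalence) means there exist $U\in\mathrm{GL}_m(\mathbb Z)$ and $\sigma\in\mathfrak S_k$ with $UM=M'P_\sigma$. -}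

module Defs where

open import Data.Nat using (ℕ; zero; suc; _+_)
open import Data.Fin using (Fin; zero; suc; splitAt; _≟_)
open import Data.Fin.Permutation using (Permutation′; _⟨$⟩ʳ_)
open import Data.Integer using (ℤ; 0ℤ; 1ℤ) renaming (_+_ to _+ℤ_; _*_ to _*ℤ_)
open import Data.Sum using (inj₁; inj₂)
open import Data.Product using (∃; ∃-syntax; _×_)
open import Relation.Binary.PropositionalEquality using (_≡_)
open import Relation.Nullary using (yes; no)

Mat : ℕ → ℕ → Set
Mat m k = Fin m → Fin k → ℤ

Σℤ : (n : ℕ) → (Fin n → ℤ) → ℤ
Σℤ zero    f = 0ℤ
Σℤ (suc n) f = f zero +ℤ Σℤ n (λ i → f (suc i))

_⊗_ : ∀ {m k l} → Mat m k → Mat k l → Mat m l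
_⊗_ {k = k} M N i j = Σℤ k (λ t → M i t *ℤ N t j)

_≈ₘ_ : ∀ {m k} → Mat m k → Mat m k → Set
M ≈ₘ N = ∀ i j → M i j ≡ N i j

I : (m : ℕ) → Mat m m
I m i j with i ≟ j
... | yes _ = 1ℤ
... | no  _ = 0ℤ

zeroMat : (m k : ℕ) → Mat m k
zeroMat m k _ _ = 0ℤ

IsUnimodular : ∀ {m} → Mat m m → Set
IsUnimodular {m} U = ∃[ V ] ((U ⊗ V) ≈ₘ I m × (V ⊗ U) ≈ₘ I m)

P : ∀ {k} → Permutation′ k → Mat k k
P σ i j with i ≟ (σ ⟨$⟩ʳ j)
... | yes _ = 1ℤ
... | no  _ = 0ℤ

_≃UP_ : ∀ {m k} → Mat m k → Mat m k → Set
_≃UP_ {m} {k} M M' =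
  ∃[ U ] ∃[ σ ] (IsUnimodular {m} U × (U ⊗ M) ≈ₘ (M' ⊗ P {k} σ))

block : ∀ {d e} → Mat d d → Mat d e → Mat e d → Mat e e → Mat (d + e) (d + e)
block {d} A B C D i j with splitAt d i | splitAt d j
... | inj₁ i' | inj₁ j' = A i' j'
... | inj₁ i' | inj₂ j' = B i' j'
... | inj₂ i' | inj₁ j' = C i' j'
... | inj₂ i' | inj₂ j' = D i' j'

-- Suppose U C₁ = D₁ P_τ, and write U_k for the k-th row of U and c_t for the t-th column of C₁.
-- The last n − d rows of C₁ and D₁ are unit rows e_k, and we modify (U, τ), one such k at a time,
-- until U_k = e_k and τ fixes k, without disturbing the rows already treated. If j = τ⁻¹ k ≠ k, then
-- w = U_k − e_k satisfies w C₁ = e_j − e_k, so the reflection I + (c_k − c_j) w exchanges columns j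
-- and k of C₁, and the transposition is absorbed into τ. Once τ fixes k, w = e_k − U_k annihilates
-- C₁, so the transvection I + c_k w fixes C₁ and turns U_k into e_k, because U_k c_k = (U C₁)_kk = 1.
-- At the end U = (U₁ ∗ ; 0 I) and τ restricts to a permutation τ₁ of the first d indices, and the
-- upper left blocks give U₁ A₁ = B₁ P_τ₁. Conversely (U, σ) lifts to ((U  B₂ − U A₂ ; 0  I), σ ⊕ id).

module Submission where

open import Defs
open import Data.Empty using (⊥-elim)
open import Data.Fin using (Fin; zero; suc; _↑ˡ_; _↑ʳ_; splitAt)
open import Data.Fin.Permutation
  using (Permutation′; _⟨$⟩ʳ_; _⟨$⟩ˡ_; inverseˡ; inverseʳ; transpose; _∘ₚ_; permutation; flip; id)
open import Data.Fin.Properties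
  using ( _≟_; suc-injective; ↑ˡ-injective; ↑ʳ-injective
        ; splitAt-↑ˡ; splitAt-↑ʳ; splitAt⁻¹-↑ˡ; splitAt⁻¹-↑ʳ; +↔⊎)
open import Data.Integer using (ℤ; 0ℤ; 1ℤ; -1ℤ; -[1+_]; -_; _-_) renaming (_+_ to _+ℤ_; _*_ to _*ℤ_)
open import Data.Integer.Properties
  using ( +-*-semiring; +-assoc; +-identityˡ; +-identityʳ; +-inverseˡ; +-inverseʳ
        ; *-assoc; *-comm; *-identityˡ; *-identityʳ; *-zeroʳ; *-distribˡ-+; neg-distribʳ-*; -1*i≡-i)
open import Data.Integer.Solver using (module +-*-Solver)
open import Algebra.Properties.Semiring.Sum +-*-semiring
  using (sum; sum-cong-≗; ∑-distrib-+; ∑-comm; *-distribˡ-sum; *-distribʳ-sum; sum-replicate-zero)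
open import Data.List using (List; []; _∷_; tabulate)
open import Data.List.Membership.Propositional using (_∈_)
open import Data.List.Membership.Propositional.Properties using (∈-tabulate⁺; ∈-tabulate⁻)
open import Data.List.Relation.Unary.Any using (here; there)
open import Data.Nat using (ℕ; zero; suc; _+_)
open import Data.Product using (_,_; _×_; Σ-syntax; proj₁; proj₂; uncurry)
open import Data.Sum using (inj₁; inj₂)
open import Data.Sum.Function.Propositional using (_⊎-↔_)
open import Function using (_∘_)
open import Function.Definitions using (Injective)
open import Function.Properties.Inverse using (↔-sym; ↔-trans)
open import Relation.Binary.PropositionalEquality
open import Relation.Nullary using (¬_; Dec; yes; no)
open import Relation.Nullary.Decidable using (dec-true; dec-false)
open +-*-Solver using (solve; _:=_; con; _:+_; _:*_; _:-_; :-_)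

Σℤ≡sum : ∀ n (f : Fin n → ℤ) → Σℤ n f ≡ sum f
Σℤ≡sum zero    f = refl
Σℤ≡sum (suc n) f = cong (f zero +ℤ_) (Σℤ≡sum n (f ∘ suc))

Σℤ-cong : ∀ n {f g : Fin n → ℤ} → f ≗ g → Σℤ n f ≡ Σℤ n g
Σℤ-cong n {f} {g} f≗g = trans (Σℤ≡sum n f) (trans (sum-cong-≗ f≗g) (sym (Σℤ≡sum n g)))

Σℤ-distrib-+ : ∀ n (f g : Fin n → ℤ) → Σℤ n (λ t → f t +ℤ g t) ≡ Σℤ n f +ℤ Σℤ n g
Σℤ-distrib-+ n f g rewrite Σℤ≡sum n (λ t → f t +ℤ g t) | Σℤ≡sum n f | Σℤ≡sum n g = ∑-distrib-+ f g

*-distribˡ-Σℤ : ∀ n x (f : Fin n → ℤ) → x *ℤ Σℤ n f ≡ Σℤ n (λ t → x *ℤ f t)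
*-distribˡ-Σℤ n x f rewrite Σℤ≡sum n f | Σℤ≡sum n (λ t → x *ℤ f t) = *-distribˡ-sum x f

*-distribʳ-Σℤ : ∀ n x (f : Fin n → ℤ) → Σℤ n f *ℤ x ≡ Σℤ n (λ t → f t *ℤ x)
*-distribʳ-Σℤ n x f rewrite Σℤ≡sum n f | Σℤ≡sum n (λ t → f t *ℤ x) = *-distribʳ-sum x f

Σℤ-neg : ∀ n (f : Fin n → ℤ) → Σℤ n (λ t → - f t) ≡ - Σℤ n f
Σℤ-neg n f = begin
  Σℤ n (λ t → - f t)       ≡⟨ Σℤ-cong n (λ t → sym (-1*i≡-i (f t))) ⟩
  Σℤ n (λ t → -1ℤ *ℤ f t)  ≡⟨ *-distribˡ-Σℤ n -1ℤ f ⟨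
  -1ℤ *ℤ Σℤ n f            ≡⟨ -1*i≡-i (Σℤ n f) ⟩
  - Σℤ n f                 ∎
  where open ≡-Reasoning

Σℤ-comm : ∀ m n (f : Fin m → Fin n → ℤ) →
          Σℤ m (λ i → Σℤ n (f i)) ≡ Σℤ n (λ j → Σℤ m (λ i → f i j))
Σℤ-comm m n f = begin
  Σℤ m (λ i → Σℤ n (f i))          ≡⟨ Σℤ-cong m (λ i → Σℤ≡sum n (f i)) ⟩
  Σℤ m (λ i → sum (f i))           ≡⟨ Σℤ≡sum m _ ⟩
  sum (λ i → sum (f i))            ≡⟨ ∑-comm f ⟩
  sum (λ j → sum (λ i → f i j))    ≡⟨ Σℤ≡sum n _ ⟨
  Σℤ n (λ j → sum (λ i → f i j))   ≡⟨ Σℤ-cong n (λ j → Σℤ≡sum m (λ i → f i j)) ⟨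
  Σℤ n (λ j → Σℤ m (λ i → f i j))  ∎
  where open ≡-Reasoning

Σℤ-zero : ∀ n {f : Fin n → ℤ} → (∀ t → f t ≡ 0ℤ) → Σℤ n f ≡ 0ℤ
Σℤ-zero n f≗0 = trans (Σℤ-cong n f≗0) (trans (Σℤ≡sum n _) (sum-replicate-zero n))

Σℤ-single : ∀ n {f : Fin n → ℤ} j → (∀ t → ¬ t ≡ j → f t ≡ 0ℤ) → Σℤ n f ≡ f j
Σℤ-single (suc n) {f} zero    f≗0 =
  trans (cong (f zero +ℤ_) (Σℤ-zero n (λ t → f≗0 (suc t) λ ()))) (+-identityʳ (f zero))
Σℤ-single (suc n) {f} (suc j) f≗0 =
  trans (cong (_+ℤ Σℤ n (f ∘ suc)) (f≗0 zero λ ()))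
        (trans (+-identityˡ _) (Σℤ-single n j (λ t t≢j → f≗0 (suc t) (t≢j ∘ suc-injective))))

Σℤ-++ : ∀ d e (f : Fin (d + e) → ℤ) →
        Σℤ (d + e) f ≡ Σℤ d (λ i → f (i ↑ˡ e)) +ℤ Σℤ e (λ s → f (d ↑ʳ s))
Σℤ-++ zero    e f = sym (+-identityˡ (Σℤ e f))
Σℤ-++ (suc d) e f = trans (cong (f zero +ℤ_) (Σℤ-++ d e (f ∘ suc))) (sym (+-assoc (f zero) _ _))

column : ∀ {m n} → Mat m n → Fin n → Fin m → ℤ
column M j i = M i j

dot : ∀ {n} → (Fin n → ℤ) → (Fin n → ℤ) → ℤ
dot {n} a b = Σℤ n (λ t → a t *ℤ b t)

dot-comm : ∀ {n} (a b : Fin n → ℤ) → dot a b ≡ dot b a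
dot-comm {n} a b = Σℤ-cong n (λ t → *-comm (a t) (b t))

dot-neg : ∀ {n} (w a : Fin n → ℤ) → dot w (λ t → - a t) ≡ - dot w a
dot-neg {n} w a = trans (Σℤ-cong n (λ t → sym (neg-distribʳ-* (w t) (a t)))) (Σℤ-neg n _)

dot-distribˡ-- : ∀ {n} (w a b : Fin n → ℤ) → dot w (λ t → a t - b t) ≡ dot w a - dot w b
dot-distribˡ-- {n} w a b = begin
  Σℤ n (λ t → w t *ℤ (a t - b t))          ≡⟨ Σℤ-cong n (λ t → *-distribˡ-+ (w t) (a t) (- b t)) ⟩
  Σℤ n (λ t → w t *ℤ a t +ℤ w t *ℤ - b t)  ≡⟨ Σℤ-distrib-+ n _ _ ⟩
  dot w a +ℤ dot w (λ t → - b t)           ≡⟨ cong (dot w a +ℤ_) (dot-neg w b) ⟩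
  dot w a - dot w b                        ∎
  where open ≡-Reasoning

dot-distribʳ-- : ∀ {n} (a b v : Fin n → ℤ) → dot (λ t → a t - b t) v ≡ dot a v - dot b v
dot-distribʳ-- a b v =
  trans (dot-comm _ v) (trans (dot-distribˡ-- v a b) (cong₂ _-_ (dot-comm v a) (dot-comm v b)))

I-diag : ∀ n i → I n i i ≡ 1ℤ
I-diag n i with i ≟ i
... | yes _   = refl
... | no i≢i = ⊥-elim (i≢i refl)

I-offdiag : ∀ n {i j} → ¬ i ≡ j → I n i j ≡ 0ℤ
I-offdiag n {i} {j} i≢j with i ≟ j
... | yes i≡j = ⊥-elim (i≢j i≡j)
... | no _    = refl

I-injective : ∀ {m n} {f : Fin m → Fin n} → Injective _≡_ _≡_ f → ∀ i j → I n (f i) (f j) ≡ I m i j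
I-injective {n = n} {f} f-inj i j with i ≟ j
... | yes refl = I-diag n (f i)
... | no i≢j   = I-offdiag n (i≢j ∘ f-inj)

I-permute : ∀ {n} (τ : Permutation′ n) k j → I n k (τ ⟨$⟩ʳ j) ≡ I n (τ ⟨$⟩ˡ k) j
I-permute {n} τ k j with τ ⟨$⟩ˡ k ≟ j
... | yes refl = trans (cong (I n k) (inverseʳ τ)) (I-diag n k)
... | no τ⁻k≢j = I-offdiag n (λ k≡τj → τ⁻k≢j (trans (cong (τ ⟨$⟩ˡ_) k≡τj) (inverseˡ τ)))

dot-identityˡ : ∀ {n} i (b : Fin n → ℤ) → dot (I n i) b ≡ b i
dot-identityˡ {n} i b = begin
  Σℤ n (λ t → I n i t *ℤ b t)  ≡⟨ Σℤ-single n i off-diagonal ⟩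
  I n i i *ℤ b i               ≡⟨ cong (_*ℤ b i) (I-diag n i) ⟩
  1ℤ *ℤ b i                    ≡⟨ *-identityˡ (b i) ⟩
  b i                          ∎
  where
  open ≡-Reasoning
  off-diagonal : ∀ t → ¬ t ≡ i → I n i t *ℤ b t ≡ 0ℤ
  off-diagonal t t≢i rewrite I-offdiag n (t≢i ∘ sym) = refl

dot-identityʳ : ∀ {n} (a : Fin n → ℤ) j → dot a (column (I n) j) ≡ a j
dot-identityʳ {n} a j = begin
  Σℤ n (λ t → a t *ℤ I n t j)  ≡⟨ Σℤ-single n j off-diagonal ⟩
  a j *ℤ I n j j               ≡⟨ cong (a j *ℤ_) (I-diag n j) ⟩
  a j *ℤ 1ℤ                    ≡⟨ *-identityʳ (a j) ⟩
  a j                          ∎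
  where
  open ≡-Reasoning
  off-diagonal : ∀ t → ¬ t ≡ j → a t *ℤ I n t j ≡ 0ℤ
  off-diagonal t t≢j rewrite I-offdiag n t≢j = *-zeroʳ (a t)

⊗-identityˡ : ∀ {m n} (M : Mat m n) → (I m ⊗ M) ≈ₘ M
⊗-identityˡ M i j = dot-identityˡ i (column M j)

⊗-congˡ : ∀ {m k n} {M M' : Mat m k} (N : Mat k n) → M ≈ₘ M' → (M ⊗ N) ≈ₘ (M' ⊗ N)
⊗-congˡ {k = k} N M≈M' i j = Σℤ-cong k (λ t → cong (_*ℤ N t j) (M≈M' i t))

⊗-congʳ : ∀ {m k n} (M : Mat m k) {N N' : Mat k n} → N ≈ₘ N' → (M ⊗ N) ≈ₘ (M ⊗ N')
⊗-congʳ {k = k} M N≈N' i j = Σℤ-cong k (λ t → cong (M i t *ℤ_) (N≈N' t j))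

⊗-assoc : ∀ {m k l n} (L : Mat m k) (M : Mat k l) (N : Mat l n) → ((L ⊗ M) ⊗ N) ≈ₘ (L ⊗ (M ⊗ N))
⊗-assoc {k = k} {l = l} L M N i j = begin
  Σℤ l (λ t → Σℤ k (λ s → L i s *ℤ M s t) *ℤ N t j)
    ≡⟨ Σℤ-cong l (λ t → *-distribʳ-Σℤ k (N t j) _) ⟩
  Σℤ l (λ t → Σℤ k (λ s → L i s *ℤ M s t *ℤ N t j))
    ≡⟨ Σℤ-comm l k _ ⟩
  Σℤ k (λ s → Σℤ l (λ t → L i s *ℤ M s t *ℤ N t j))
    ≡⟨ Σℤ-cong k (λ s → Σℤ-cong l (λ t → *-assoc (L i s) _ _)) ⟩
  Σℤ k (λ s → Σℤ l (λ t → L i s *ℤ (M s t *ℤ N t j)))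
    ≡⟨ Σℤ-cong k (λ s → *-distribˡ-Σℤ l (L i s) _) ⟨
  Σℤ k (λ s → L i s *ℤ Σℤ l (λ t → M s t *ℤ N t j))
    ∎
  where open ≡-Reasoning

⊗-negʳ : ∀ {m k n} (M : Mat m k) (N : Mat k n) i j → (M ⊗ (λ t l → - N t l)) i j ≡ - (M ⊗ N) i j
⊗-negʳ M N i j = dot-neg (M i) (column N j)

P-as-I : ∀ {k} (σ : Permutation′ k) i j → P σ i j ≡ I k i (σ ⟨$⟩ʳ j)
P-as-I σ i j with i ≟ σ ⟨$⟩ʳ j
... | yes _ = refl
... | no _  = refl

⊗-P : ∀ {m k} (X : Mat m k) (σ : Permutation′ k) i j → (X ⊗ P σ) i j ≡ X i (σ ⟨$⟩ʳ j)
⊗-P {k = k} X σ i j =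
  trans (Σℤ-cong k (λ t → cong (X i t *ℤ_) (P-as-I σ t j))) (dot-identityʳ (X i) (σ ⟨$⟩ʳ j))

⊗-unimodular : ∀ {n} {U U' : Mat n n} → IsUnimodular U → IsUnimodular U' → IsUnimodular (U ⊗ U')
⊗-unimodular {n} {U} {U'} (V , UV≈I , VU≈I) (V' , U'V'≈I , V'U'≈I) =
  V' ⊗ V , cancel U U' V' V U'V'≈I UV≈I , cancel V' V U U' VU≈I V'U'≈I
  where
  cancel : ∀ A B B' A' → (B ⊗ B') ≈ₘ I n → (A ⊗ A') ≈ₘ I n → ((A ⊗ B) ⊗ (B' ⊗ A')) ≈ₘ I n
  cancel A B B' A' BB'≈I AA'≈I i j = begin
    ((A ⊗ B) ⊗ (B' ⊗ A')) i j  ≡⟨ ⊗-assoc A B (B' ⊗ A') i j ⟩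
    (A ⊗ (B ⊗ (B' ⊗ A'))) i j  ≡⟨ ⊗-congʳ A (λ k l → sym (⊗-assoc B B' A' k l)) i j ⟩
    (A ⊗ ((B ⊗ B') ⊗ A')) i j  ≡⟨ ⊗-congʳ A (⊗-congˡ A' BB'≈I) i j ⟩
    (A ⊗ (I n ⊗ A')) i j       ≡⟨ ⊗-congʳ A (⊗-identityˡ A') i j ⟩
    (A ⊗ A') i j               ≡⟨ AA'≈I i j ⟩
    I n i j                    ∎
    where open ≡-Reasoning

UnitRow : ∀ {n} → Mat n n → Fin n → Set
UnitRow {n} M k = ∀ j → M k j ≡ I n k j

unitRow-⊗ : ∀ {n m} (U : Mat n n) {k} → UnitRow U k → (M : Mat n m) → ∀ j → (U ⊗ M) k j ≡ M k j
unitRow-⊗ {n} U {k} Uk M j =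
  trans (Σℤ-cong n (λ t → cong (_*ℤ M t j) (Uk t))) (dot-identityˡ k (column M j))

I+_∙_ᵀ : ∀ {n} → (Fin n → ℤ) → (Fin n → ℤ) → Mat n n
(I+_∙_ᵀ {n} a w) i j = I n i j +ℤ a i *ℤ w j

I+∙ᵀ-⊗ : ∀ {n m} (a w : Fin n → ℤ) (M : Mat n m) i j →
         ((I+ a ∙ w ᵀ) ⊗ M) i j ≡ M i j +ℤ a i *ℤ dot w (column M j)
I+∙ᵀ-⊗ {n} a w M i j = begin
  Σℤ n (λ t → (I n i t +ℤ a i *ℤ w t) *ℤ M t j)
    ≡⟨ Σℤ-cong n (λ t → expand (I n i t) (a i) (w t) (M t j)) ⟩
  Σℤ n (λ t → I n i t *ℤ M t j +ℤ a i *ℤ (w t *ℤ M t j))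
    ≡⟨ Σℤ-distrib-+ n _ _ ⟩
  dot (I n i) (column M j) +ℤ Σℤ n (λ t → a i *ℤ (w t *ℤ M t j))
    ≡⟨ cong₂ _+ℤ_ (dot-identityˡ i _) (sym (*-distribˡ-Σℤ n (a i) _)) ⟩
  M i j +ℤ a i *ℤ dot w (column M j)
    ∎
  where
  open ≡-Reasoning
  expand : ∀ x y z u → (x +ℤ y *ℤ z) *ℤ u ≡ x *ℤ u +ℤ y *ℤ (z *ℤ u)
  expand = solve 4 (λ x y z u → (x :+ y :* z) :* u := x :* u :+ y :* (z :* u)) refl

dot-column-I+∙ᵀ : ∀ {n} (v a w : Fin n → ℤ) j → dot v (column (I+ a ∙ w ᵀ) j) ≡ v j +ℤ dot v a *ℤ w j
dot-column-I+∙ᵀ {n} v a w j = begin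
  Σℤ n (λ t → v t *ℤ (I n t j +ℤ a t *ℤ w j))
    ≡⟨ Σℤ-cong n (λ t → expand (v t) (I n t j) (a t) (w j)) ⟩
  Σℤ n (λ t → v t *ℤ I n t j +ℤ v t *ℤ a t *ℤ w j)
    ≡⟨ Σℤ-distrib-+ n _ _ ⟩
  dot v (column (I n) j) +ℤ Σℤ n (λ t → v t *ℤ a t *ℤ w j)
    ≡⟨ cong₂ _+ℤ_ (dot-identityʳ v j) (sym (*-distribʳ-Σℤ n (w j) _)) ⟩
  v j +ℤ dot v a *ℤ w j
    ∎
  where
  open ≡-Reasoning
  expand : ∀ x y z u → x *ℤ (y +ℤ z *ℤ u) ≡ x *ℤ y +ℤ x *ℤ z *ℤ u
  expand = solve 4 (λ x y z u → x :* (y :+ z :* u) := x :* y :+ x :* z :* u) refl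

I+∙ᵀ-⊗-I+∙ᵀ : ∀ {n} (a c w : Fin n → ℤ) → (∀ i → a i +ℤ c i +ℤ dot w c *ℤ a i ≡ 0ℤ) →
              ((I+ a ∙ w ᵀ) ⊗ (I+ c ∙ w ᵀ)) ≈ₘ I n
I+∙ᵀ-⊗-I+∙ᵀ {n} a c w vanishes i j = begin
  ((I+ a ∙ w ᵀ) ⊗ (I+ c ∙ w ᵀ)) i j
    ≡⟨ I+∙ᵀ-⊗ a w (I+ c ∙ w ᵀ) i j ⟩
  I n i j +ℤ c i *ℤ w j +ℤ a i *ℤ dot w (column (I+ c ∙ w ᵀ) j)
    ≡⟨ cong (λ x → I n i j +ℤ c i *ℤ w j +ℤ a i *ℤ x) (dot-column-I+∙ᵀ w c w j) ⟩
  I n i j +ℤ c i *ℤ w j +ℤ a i *ℤ (w j +ℤ dot w c *ℤ w j)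
    ≡⟨ collect (I n i j) (a i) (c i) (w j) (dot w c) ⟩
  I n i j +ℤ (a i +ℤ c i +ℤ dot w c *ℤ a i) *ℤ w j
    ≡⟨ cong (λ x → I n i j +ℤ x *ℤ w j) (vanishes i) ⟩
  I n i j +ℤ 0ℤ *ℤ w j
    ≡⟨ +-identityʳ (I n i j) ⟩
  I n i j
    ∎
  where
  open ≡-Reasoning
  collect : ∀ e x y u d → e +ℤ y *ℤ u +ℤ x *ℤ (u +ℤ d *ℤ u) ≡ e +ℤ (x +ℤ y +ℤ d *ℤ x) *ℤ u
  collect = solve 5 (λ e x y u d → e :+ y :* u :+ x :* (u :+ d :* u) := e :+ (x :+ y :+ d :* x) :* u) refl

transvection-unimodular : ∀ {n} (a w : Fin n → ℤ) → dot w a ≡ 0ℤ → IsUnimodular (I+ a ∙ w ᵀ)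
transvection-unimodular {n} a w w·a≡0 =
  I+ -a ∙ w ᵀ , I+∙ᵀ-⊗-I+∙ᵀ a -a w right , I+∙ᵀ-⊗-I+∙ᵀ -a a w left
  where
  -a : Fin n → ℤ
  -a t = - a t
  right : ∀ i → a i +ℤ -a i +ℤ dot w -a *ℤ a i ≡ 0ℤ
  right i rewrite dot-neg w a | w·a≡0 = solve 1 (λ x → x :+ :- x :+ con 0ℤ :* x := con 0ℤ) refl (a i)
  left : ∀ i → -a i +ℤ a i +ℤ dot w a *ℤ -a i ≡ 0ℤ
  left i rewrite w·a≡0 = solve 1 (λ x → :- x :+ x :+ con 0ℤ :* (:- x) := con 0ℤ) refl (a i)

reflection-unimodular : ∀ {n} (a w : Fin n → ℤ) → dot w a ≡ -[1+ 1 ] → IsUnimodular (I+ a ∙ w ᵀ)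
reflection-unimodular a w w·a≡-2 = I+ a ∙ w ᵀ , involution , involution
  where
  vanishes : ∀ i → a i +ℤ a i +ℤ dot w a *ℤ a i ≡ 0ℤ
  vanishes i rewrite w·a≡-2 = solve 1 (λ x → x :+ x :+ con -[1+ 1 ] :* x := con 0ℤ) refl (a i)
  involution : ((I+ a ∙ w ᵀ) ⊗ (I+ a ∙ w ᵀ)) ≈ₘ I _
  involution = I+∙ᵀ-⊗-I+∙ᵀ a a w vanishes

unitRow-⊗-I+∙ᵀ : ∀ {n} (U : Mat n n) {r} (a w : Fin n → ℤ) → UnitRow U r → a r ≡ 0ℤ →
                 UnitRow (U ⊗ (I+ a ∙ w ᵀ)) r
unitRow-⊗-I+∙ᵀ {n} U {r} a w Ur ar≡0 j rewrite unitRow-⊗ U Ur (I+ a ∙ w ᵀ) j | ar≡0 =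
  +-identityʳ (I n r j)

I+∙ᵀ-⊗-annihilated : ∀ {n m} (a w : Fin n → ℤ) (M : Mat n m) → (∀ j → dot w (column M j) ≡ 0ℤ) →
                      ((I+ a ∙ w ᵀ) ⊗ M) ≈ₘ M
I+∙ᵀ-⊗-annihilated a w M w⊥M i j rewrite I+∙ᵀ-⊗ a w M i j | w⊥M j =
  solve 2 (λ x y → x :+ y :* con 0ℤ := x) refl (M i j) (a i)

transpose-left : ∀ {n} (p q : Fin n) → transpose p q ⟨$⟩ʳ p ≡ q
transpose-left p q rewrite dec-true (p ≟ p) refl = refl

transpose-right : ∀ {n} (p q : Fin n) → transpose p q ⟨$⟩ʳ q ≡ p
transpose-right p q with q ≟ p
... | yes refl = refl
... | no _ rewrite dec-true (q ≟ q) refl = refl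

transpose-other : ∀ {n} {p q t : Fin n} → ¬ t ≡ p → ¬ t ≡ q → transpose p q ⟨$⟩ʳ t ≡ t
transpose-other {p = p} {q} {t} t≢p t≢q rewrite dec-false (t ≟ p) t≢p | dec-false (t ≟ q) t≢q = refl

module ColumnSwap {n m} (w : Fin n → ℤ) (M : Mat n m) {p q : Fin m} (p≢q : ¬ p ≡ q)
                  (w⊗M : ∀ t → dot w (column M t) ≡ I m p t - I m q t) where

  difference : Fin n → ℤ
  difference r = M r q - M r p

  swaps : ∀ i t → ((I+ difference ∙ w ᵀ) ⊗ M) i t ≡ M i (transpose p q ⟨$⟩ʳ t)
  swaps i t rewrite I+∙ᵀ-⊗ difference w M i t | w⊗M t = cases t (t ≟ p) (t ≟ q)
    where
    cases : ∀ t → Dec (t ≡ p) → Dec (t ≡ q) →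
            M i t +ℤ difference i *ℤ (I m p t - I m q t) ≡ M i (transpose p q ⟨$⟩ʳ t)
    cases t (yes refl) _
      rewrite transpose-left p q | I-diag m p | I-offdiag m (p≢q ∘ sym) =
      solve 2 (λ x y → y :+ (x :- y) :* (con 1ℤ :- con 0ℤ) := x) refl (M i q) (M i p)
    cases t (no _) (yes refl)
      rewrite transpose-right p q | I-diag m q | I-offdiag m p≢q =
      solve 2 (λ x y → x :+ (x :- y) :* (con 0ℤ :- con 1ℤ) := y) refl (M i q) (M i p)
    cases t (no t≢p) (no t≢q)
      rewrite transpose-other t≢p t≢q | I-offdiag m (t≢p ∘ sym) | I-offdiag m (t≢q ∘ sym) =
      solve 2 (λ x y → x :+ y :* (con 0ℤ :- con 0ℤ) := x) refl (M i t) (difference i)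

  unimodular : IsUnimodular (I+ difference ∙ w ᵀ)
  unimodular = reflection-unimodular difference w (begin
    dot w difference
      ≡⟨ dot-distribˡ-- w (column M q) (column M p) ⟩
    dot w (column M q) - dot w (column M p)
      ≡⟨ cong₂ _-_ (w⊗M q) (w⊗M p) ⟩
    (I m p q - I m q q) - (I m p p - I m q p)
      ≡⟨ cong₂ (λ x y → (x - I m q q) - (I m p p - y)) (I-offdiag m p≢q) (I-offdiag m (p≢q ∘ sym)) ⟩
    (0ℤ - I m q q) - (I m p p - 0ℤ)
      ≡⟨ cong₂ (λ x y → (0ℤ - x) - (y - 0ℤ)) (I-diag m q) (I-diag m p) ⟩
    -[1+ 1 ]
      ∎)
    where open ≡-Reasoning

module Normalisation {n} (C D : Mat n n) where

  record Normalised (ks : List (Fin n)) : Set where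
    field
      U            : Mat n n
      τ            : Permutation′ n
      U-unimodular : IsUnimodular U
      U⊗C≡Dτ       : ∀ i j → (U ⊗ C) i j ≡ D i (τ ⟨$⟩ʳ j)
      U-unitRow    : ∀ {k} → k ∈ ks → UnitRow U k
      τ-fixes      : ∀ {k} → k ∈ ks → τ ⟨$⟩ʳ k ≡ k

  fromUP : C ≃UP D → Normalised []
  fromUP (U , τ , U-unimodular , U⊗C≈D⊗Pτ) = record
    { U = U ; τ = τ ; U-unimodular = U-unimodular
    ; U⊗C≡Dτ = λ i j → trans (U⊗C≈D⊗Pτ i j) (⊗-P D τ i j)
    ; U-unitRow = λ () ; τ-fixes = λ () }

  module Step {ks k} (Ck : UnitRow C k) (Dk : UnitRow D k) (Cks : ∀ {k'} → k' ∈ ks → UnitRow C k') where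

    row-U⊗C : (W : Normalised ks) → ∀ j → (Normalised.U W ⊗ C) k j ≡ I n (Normalised.τ W ⟨$⟩ˡ k) j
    row-U⊗C W j = trans (Normalised.U⊗C≡Dτ W k j) (trans (Dk _) (I-permute (Normalised.τ W) k j))

    moveInPlace : (W : Normalised ks) → ¬ Normalised.τ W ⟨$⟩ˡ k ≡ k →
                  Σ[ W' ∈ Normalised ks ] Normalised.τ W' ⟨$⟩ʳ k ≡ k
    moveInPlace W j≢k = record
      { U = U ⊗ G ; τ = transpose j k ∘ₚ τ ; U-unimodular = ⊗-unimodular U-unimodular unimodular
      ; U⊗C≡Dτ = λ i t → trans (⊗-assoc U G C i t) (trans (⊗-congʳ U swaps-columns i t) (U⊗C≡Dτ i _))
      ; U-unitRow = λ k'∈ks → unitRow-⊗-I+∙ᵀ U difference w (U-unitRow k'∈ks) (difference-vanishes k'∈ks)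
      ; τ-fixes = λ k'∈ks →
          trans (cong (τ ⟨$⟩ʳ_) (transpose-other (≢j k'∈ks) (≢k k'∈ks))) (τ-fixes k'∈ks) }
      , trans (cong (τ ⟨$⟩ʳ_) (transpose-right j k)) (inverseʳ τ)
      where
      open Normalised W
      j : Fin n
      j = τ ⟨$⟩ˡ k
      w : Fin n → ℤ
      w t = U k t - I n k t
      w⊗C : ∀ t → dot w (column C t) ≡ I n j t - I n k t
      w⊗C t = trans (dot-distribʳ-- (U k) (I n k) (column C t))
                    (cong₂ _-_ (row-U⊗C W t) (trans (dot-identityˡ k (column C t)) (Ck t)))
      open ColumnSwap w C j≢k w⊗C
      G : Mat n n
      G = I+ difference ∙ w ᵀ
      swaps-columns : (G ⊗ C) ≈ₘ (λ i t → C i (transpose j k ⟨$⟩ʳ t))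
      swaps-columns = swaps
      ≢k : ∀ {k'} → k' ∈ ks → ¬ k' ≡ k
      ≢k k'∈ks refl = j≢k (trans (cong (τ ⟨$⟩ˡ_) (sym (τ-fixes k'∈ks))) (inverseˡ τ))
      ≢j : ∀ {k'} → k' ∈ ks → ¬ k' ≡ j
      ≢j k'∈ks refl = j≢k (trans (sym (τ-fixes k'∈ks)) (inverseʳ τ))
      difference-vanishes : ∀ {k'} → k' ∈ ks → difference k' ≡ 0ℤ
      difference-vanishes k'∈ks = cong₂ _-_ (trans (Cks k'∈ks k) (I-offdiag n (≢k k'∈ks)))
                                            (trans (Cks k'∈ks j) (I-offdiag n (≢j k'∈ks)))

    fixColumn : Normalised ks → Σ[ W ∈ Normalised ks ] Normalised.τ W ⟨$⟩ʳ k ≡ k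
    fixColumn W with Normalised.τ W ⟨$⟩ˡ k ≟ k
    ... | yes τ⁻k≡k = W , trans (cong (Normalised.τ W ⟨$⟩ʳ_) (sym τ⁻k≡k)) (inverseʳ (Normalised.τ W))
    ... | no τ⁻k≢k  = moveInPlace W τ⁻k≢k

    clearRow : (W : Normalised ks) → Normalised.τ W ⟨$⟩ʳ k ≡ k → Normalised (k ∷ ks)
    clearRow W τk≡k = record
      { U = U ⊗ G ; τ = τ ; U-unimodular = ⊗-unimodular U-unimodular (transvection-unimodular c w (w⊥C k))
      ; U⊗C≡Dτ = λ i j → trans (⊗-assoc U G C i j)
                               (trans (⊗-congʳ U (I+∙ᵀ-⊗-annihilated c w C w⊥C) i j) (U⊗C≡Dτ i j))
      ; U-unitRow = λ { (here refl) → row-k ; (there k'∈ks) → row-k' k'∈ks }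
      ; τ-fixes = λ { (here refl) → τk≡k ; (there k'∈ks) → τ-fixes k'∈ks } }
      where
      open Normalised W
      c w : Fin n → ℤ
      c = column C k
      w t = I n k t - U k t
      τ⁻k≡k : τ ⟨$⟩ˡ k ≡ k
      τ⁻k≡k = trans (cong (τ ⟨$⟩ˡ_) (sym τk≡k)) (inverseˡ τ)
      row-k-U⊗C : UnitRow (U ⊗ C) k
      row-k-U⊗C j = trans (row-U⊗C W j) (cong (λ x → I n x j) τ⁻k≡k)
      w⊥C : ∀ j → dot w (column C j) ≡ 0ℤ
      w⊥C j = trans (dot-distribʳ-- (I n k) (U k) (column C j))
        (trans (cong₂ _-_ (trans (dot-identityˡ k (column C j)) (Ck j)) (row-k-U⊗C j)) (+-inverseʳ (I n k j)))
      G : Mat n n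
      G = I+ c ∙ w ᵀ
      row-k : UnitRow (U ⊗ G) k
      row-k j = begin
        (U ⊗ G) k j
          ≡⟨ dot-column-I+∙ᵀ (U k) c w j ⟩
        U k j +ℤ (U ⊗ C) k k *ℤ (I n k j - U k j)
          ≡⟨ cong (λ x → U k j +ℤ x *ℤ (I n k j - U k j)) (trans (row-k-U⊗C k) (I-diag n k)) ⟩
        U k j +ℤ 1ℤ *ℤ (I n k j - U k j)
          ≡⟨ solve 2 (λ u e → u :+ con 1ℤ :* (e :- u) := e) refl (U k j) (I n k j) ⟩
        I n k j
          ∎
        where open ≡-Reasoning
      row-k' : ∀ {k'} → k' ∈ ks → UnitRow (U ⊗ G) k'
      row-k' {k'} k'∈ks with k' ≟ k
      ... | yes refl = row-k
      ... | no k'≢k  = unitRow-⊗-I+∙ᵀ U c w (U-unitRow k'∈ks) (trans (Cks k'∈ks k) (I-offdiag n k'≢k))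

  normalise : ∀ ks → (∀ {k} → k ∈ ks → UnitRow C k) → (∀ {k} → k ∈ ks → UnitRow D k) →
              C ≃UP D → Normalised ks
  normalise []       _  _  C≃D = fromUP C≃D
  normalise (k ∷ ks) Cs Ds C≃D = uncurry clearRow (fixColumn (normalise ks (Cs ∘ there) (Ds ∘ there) C≃D))
    where open Step (Cs (here refl)) (Ds (here refl)) (Cs ∘ there)

data BlockIndex (d e : ℕ) : Fin (d + e) → Set where
  upper : (i : Fin d) → BlockIndex d e (i ↑ˡ e)
  lower : (s : Fin e) → BlockIndex d e (d ↑ʳ s)

blockIndex : ∀ {d e} (i : Fin (d + e)) → BlockIndex d e i
blockIndex {d} {e} i with splitAt d i in eq
... | inj₁ i' = subst (BlockIndex d e) (splitAt⁻¹-↑ˡ eq) (upper i')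
... | inj₂ s  = subst (BlockIndex d e) (splitAt⁻¹-↑ʳ eq) (lower s)

↑ˡ≢↑ʳ : ∀ {d e} (i : Fin d) (s : Fin e) → ¬ i ↑ˡ e ≡ d ↑ʳ s
↑ˡ≢↑ʳ {d} {e} i s eq with trans (sym (splitAt-↑ˡ d i e)) (trans (cong (splitAt d) eq) (splitAt-↑ʳ d e s))
... | ()

module _ {d e} (A : Mat d d) (B : Mat d e) (C : Mat e d) (D : Mat e e) where

  block-↖ : ∀ i j → block A B C D (i ↑ˡ e) (j ↑ˡ e) ≡ A i j
  block-↖ i j rewrite splitAt-↑ˡ d i e | splitAt-↑ˡ d j e = refl

  block-↗ : ∀ i s → block A B C D (i ↑ˡ e) (d ↑ʳ s) ≡ B i s
  block-↗ i s rewrite splitAt-↑ˡ d i e | splitAt-↑ʳ d e s = refl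

  block-↙ : ∀ s j → block A B C D (d ↑ʳ s) (j ↑ˡ e) ≡ C s j
  block-↙ s j rewrite splitAt-↑ʳ d e s | splitAt-↑ˡ d j e = refl

  block-↘ : ∀ r s → block A B C D (d ↑ʳ r) (d ↑ʳ s) ≡ D r s
  block-↘ r s rewrite splitAt-↑ʳ d e r | splitAt-↑ʳ d e s = refl

block-cong : ∀ {d e} {A A' : Mat d d} {B B' : Mat d e} {C C' : Mat e d} {D D' : Mat e e} →
             A ≈ₘ A' → B ≈ₘ B' → C ≈ₘ C' → D ≈ₘ D' → block A B C D ≈ₘ block A' B' C' D'
block-cong {d} A≈A' B≈B' C≈C' D≈D' i j with splitAt d i | splitAt d j
... | inj₁ i' | inj₁ j' = A≈A' i' j'
... | inj₁ i' | inj₂ s  = B≈B' i' s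
... | inj₂ r  | inj₁ j' = C≈C' r j'
... | inj₂ r  | inj₂ s  = D≈D' r s

module _ {d e : ℕ} where

  I-↖ : ∀ i j → I (d + e) (i ↑ˡ e) (j ↑ˡ e) ≡ I d i j
  I-↖ = I-injective (↑ˡ-injective e _ _)

  I-↗ : ∀ i s → I (d + e) (i ↑ˡ e) (d ↑ʳ s) ≡ 0ℤ
  I-↗ i s = I-offdiag (d + e) (↑ˡ≢↑ʳ i s)

  I-↙ : ∀ s j → I (d + e) (d ↑ʳ s) (j ↑ˡ e) ≡ 0ℤ
  I-↙ s j = I-offdiag (d + e) (↑ˡ≢↑ʳ j s ∘ sym)

  I-↘ : ∀ r s → I (d + e) (d ↑ʳ r) (d ↑ʳ s) ≡ I e r s
  I-↘ = I-injective (↑ʳ-injective d _ _)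

upperLeft : ∀ {d e} → Mat (d + e) (d + e) → Mat d d
upperLeft {e = e} M i j = M (i ↑ˡ e) (j ↑ˡ e)

upperLeft-⊗ : ∀ {d e} (M N : Mat (d + e) (d + e)) → (∀ s j → N (d ↑ʳ s) (j ↑ˡ e) ≡ 0ℤ) →
              upperLeft (M ⊗ N) ≈ₘ (upperLeft M ⊗ upperLeft N)
upperLeft-⊗ {d} {e} M N lowerLeft≡0 i j = begin
  (M ⊗ N) (i ↑ˡ e) (j ↑ˡ e)
    ≡⟨ Σℤ-++ d e _ ⟩
  (upperLeft M ⊗ upperLeft N) i j +ℤ Σℤ e (λ s → M (i ↑ˡ e) (d ↑ʳ s) *ℤ N (d ↑ʳ s) (j ↑ˡ e))
    ≡⟨ cong ((upperLeft M ⊗ upperLeft N) i j +ℤ_) (Σℤ-zero e upperRight×lowerLeft≡0) ⟩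
  (upperLeft M ⊗ upperLeft N) i j +ℤ 0ℤ
    ≡⟨ +-identityʳ _ ⟩
  (upperLeft M ⊗ upperLeft N) i j
    ∎
  where
  open ≡-Reasoning
  upperRight×lowerLeft≡0 : ∀ s → M (i ↑ˡ e) (d ↑ʳ s) *ℤ N (d ↑ʳ s) (j ↑ˡ e) ≡ 0ℤ
  upperRight×lowerLeft≡0 s rewrite lowerLeft≡0 s j = *-zeroʳ (M (i ↑ˡ e) (d ↑ʳ s))

upperBlock : ∀ {d e} → Mat d d → Mat d e → Mat (d + e) (d + e)
upperBlock {d} {e} A B = block A B (zeroMat e d) (I e)

module _ {d e} (A : Mat d d) (B : Mat d e) where

  upperBlock-unitRow : ∀ s → UnitRow (upperBlock A B) (d ↑ʳ s)
  upperBlock-unitRow r j with blockIndex {d} {e} j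
  ... | upper j' = trans (block-↙ A B _ _ r j') (sym (I-↙ r j'))
  ... | lower s  = trans (block-↘ A B _ _ r s) (sym (I-↘ r s))

  upperBlock-⊗-↑ˡ : ∀ (N : Mat (d + e) (d + e)) i j →
                    (upperBlock A B ⊗ N) (i ↑ˡ e) j ≡
                    Σℤ d (λ t → A i t *ℤ N (t ↑ˡ e) j) +ℤ Σℤ e (λ s → B i s *ℤ N (d ↑ʳ s) j)
  upperBlock-⊗-↑ˡ N i j = trans (Σℤ-++ d e _)
    (cong₂ _+ℤ_ (Σℤ-cong d (λ t → cong (_*ℤ N (t ↑ˡ e) j) (block-↖ A B _ _ i t)))
                (Σℤ-cong e (λ s → cong (_*ℤ N (d ↑ʳ s) j) (block-↗ A B _ _ i s))))

upperBlock-⊗-upperBlock : ∀ {d e} (A : Mat d d) (B : Mat d e) (A' : Mat d d) (B' : Mat d e) →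
  (upperBlock A B ⊗ upperBlock A' B') ≈ₘ upperBlock (A ⊗ A') (λ i s → (A ⊗ B') i s +ℤ B i s)
upperBlock-⊗-upperBlock {d} {e} A B A' B' i j with blockIndex {d} {e} i | blockIndex {d} {e} j
... | upper i | upper j = begin
  (upperBlock A B ⊗ N) (i ↑ˡ e) (j ↑ˡ e)
    ≡⟨ upperBlock-⊗-↑ˡ A B N i (j ↑ˡ e) ⟩
  Σℤ d (λ t → A i t *ℤ N (t ↑ˡ e) (j ↑ˡ e)) +ℤ Σℤ e (λ s → B i s *ℤ N (d ↑ʳ s) (j ↑ˡ e))
    ≡⟨ cong₂ _+ℤ_ (Σℤ-cong d (λ t → cong (A i t *ℤ_) (block-↖ A' B' _ _ t j)))
                  (Σℤ-zero e (λ s → trans (cong (B i s *ℤ_) (block-↙ A' B' _ _ s j)) (*-zeroʳ (B i s)))) ⟩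
  (A ⊗ A') i j +ℤ 0ℤ
    ≡⟨ +-identityʳ _ ⟩
  (A ⊗ A') i j
    ≡⟨ block-↖ _ _ _ _ i j ⟨
  upperBlock (A ⊗ A') _ (i ↑ˡ e) (j ↑ˡ e)
    ∎
  where
  open ≡-Reasoning
  N : Mat (d + e) (d + e)
  N = upperBlock A' B'
... | upper i | lower s = begin
  (upperBlock A B ⊗ N) (i ↑ˡ e) (d ↑ʳ s)
    ≡⟨ upperBlock-⊗-↑ˡ A B N i (d ↑ʳ s) ⟩
  Σℤ d (λ t → A i t *ℤ N (t ↑ˡ e) (d ↑ʳ s)) +ℤ Σℤ e (λ r → B i r *ℤ N (d ↑ʳ r) (d ↑ʳ s))
    ≡⟨ cong₂ _+ℤ_ (Σℤ-cong d (λ t → cong (A i t *ℤ_) (block-↗ A' B' _ _ t s)))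
                  (Σℤ-cong e (λ r → cong (B i r *ℤ_) (block-↘ A' B' _ _ r s))) ⟩
  (A ⊗ B') i s +ℤ dot (B i) (column (I e) s)
    ≡⟨ cong ((A ⊗ B') i s +ℤ_) (dot-identityʳ (B i) s) ⟩
  (A ⊗ B') i s +ℤ B i s
    ≡⟨ block-↗ _ _ _ _ i s ⟨
  upperBlock (A ⊗ A') _ (i ↑ˡ e) (d ↑ʳ s)
    ∎
  where
  open ≡-Reasoning
  N : Mat (d + e) (d + e)
  N = upperBlock A' B'
... | lower r | _ = trans (unitRow-⊗ (upperBlock A B) (upperBlock-unitRow A B r) (upperBlock A' B') j)
                          (trans (upperBlock-unitRow A' B' r j) (sym (upperBlock-unitRow (A ⊗ A') _ r j)))

upperBlock-cong : ∀ {d e} {A A' : Mat d d} {B B' : Mat d e} →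
                  A ≈ₘ A' → B ≈ₘ B' → upperBlock A B ≈ₘ upperBlock A' B'
upperBlock-cong A≈A' B≈B' = block-cong A≈A' B≈B' (λ _ _ → refl) (λ _ _ → refl)

upperBlock-identity : ∀ {d e} → upperBlock (I d) (zeroMat d e) ≈ₘ I (d + e)
upperBlock-identity {d} {e} i j with blockIndex {d} {e} i | blockIndex {d} {e} j
... | upper i | upper j = trans (block-↖ (I d) (zeroMat d e) (zeroMat e d) (I e) i j) (sym (I-↖ i j))
... | upper i | lower s = trans (block-↗ (I d) (zeroMat d e) (zeroMat e d) (I e) i s) (sym (I-↗ i s))
... | lower r | upper j = trans (block-↙ (I d) (zeroMat d e) (zeroMat e d) (I e) r j) (sym (I-↙ r j))
... | lower r | lower s = trans (block-↘ (I d) (zeroMat d e) (zeroMat e d) (I e) r s) (sym (I-↘ r s))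

upperBlock-unimodular : ∀ {d e} {U : Mat d d} (X : Mat d e) → IsUnimodular U → IsUnimodular (upperBlock U X)
upperBlock-unimodular {d} {e} {U} X (V , U⊗V≈I , V⊗U≈I) = upperBlock V Y , U'⊗V'≈I , V'⊗U'≈I
  where
  Y : Mat d e
  Y i s = - (V ⊗ X) i s
  V⊗X+Y≡0 : ∀ i s → (V ⊗ X) i s +ℤ Y i s ≡ 0ℤ
  V⊗X+Y≡0 i s = +-inverseʳ ((V ⊗ X) i s)
  U⊗Y+X≡0 : ∀ i s → (U ⊗ Y) i s +ℤ X i s ≡ 0ℤ
  U⊗Y+X≡0 i s = begin
    (U ⊗ Y) i s +ℤ X i s          ≡⟨ cong (_+ℤ X i s) (⊗-negʳ U (V ⊗ X) i s) ⟩
    - (U ⊗ (V ⊗ X)) i s +ℤ X i s  ≡⟨ cong (λ x → - x +ℤ X i s) (⊗-assoc U V X i s) ⟨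
    - ((U ⊗ V) ⊗ X) i s +ℤ X i s  ≡⟨ cong (λ x → - x +ℤ X i s) (⊗-congˡ X U⊗V≈I i s) ⟩
    - (I d ⊗ X) i s +ℤ X i s      ≡⟨ cong (λ x → - x +ℤ X i s) (⊗-identityˡ X i s) ⟩
    - X i s +ℤ X i s              ≡⟨ +-inverseˡ (X i s) ⟩
    0ℤ                            ∎
    where open ≡-Reasoning
  U'⊗V'≈I : (upperBlock U X ⊗ upperBlock V Y) ≈ₘ I (d + e)
  U'⊗V'≈I i j = begin
    (upperBlock U X ⊗ upperBlock V Y) i j                  ≡⟨ upperBlock-⊗-upperBlock U X V Y i j ⟩
    upperBlock (U ⊗ V) (λ i s → (U ⊗ Y) i s +ℤ X i s) i j  ≡⟨ upperBlock-cong U⊗V≈I U⊗Y+X≡0 i j ⟩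
    upperBlock (I d) (zeroMat d e) i j                     ≡⟨ upperBlock-identity {d} {e} i j ⟩
    I (d + e) i j                                          ∎
    where open ≡-Reasoning
  V'⊗U'≈I : (upperBlock V Y ⊗ upperBlock U X) ≈ₘ I (d + e)
  V'⊗U'≈I i j = begin
    (upperBlock V Y ⊗ upperBlock U X) i j                  ≡⟨ upperBlock-⊗-upperBlock V Y U X i j ⟩
    upperBlock (V ⊗ U) (λ i s → (V ⊗ X) i s +ℤ Y i s) i j  ≡⟨ upperBlock-cong V⊗U≈I V⊗X+Y≡0 i j ⟩
    upperBlock (I d) (zeroMat d e) i j                     ≡⟨ upperBlock-identity {d} {e} i j ⟩
    I (d + e) i j                                          ∎
    where open ≡-Reasoning

_⊕id : ∀ {d e} → Permutation′ d → Permutation′ (d + e)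
σ ⊕id = ↔-trans +↔⊎ (↔-trans (σ ⊎-↔ id) (↔-sym +↔⊎))

⊕id-↑ˡ : ∀ {d e} (σ : Permutation′ d) i → (_⊕id {e = e} σ) ⟨$⟩ʳ (i ↑ˡ e) ≡ (σ ⟨$⟩ʳ i) ↑ˡ e
⊕id-↑ˡ {d} {e} σ i rewrite splitAt-↑ˡ d i e = refl

⊕id-↑ʳ : ∀ {d e} (σ : Permutation′ d) s → (_⊕id {e = e} σ) ⟨$⟩ʳ (d ↑ʳ s) ≡ d ↑ʳ s
⊕id-↑ʳ {d} {e} σ s rewrite splitAt-↑ʳ d e s = refl

upperBlock-⊗-P : ∀ {d e} (A : Mat d d) (B : Mat d e) (σ : Permutation′ d) →
                 (upperBlock A B ⊗ P (σ ⊕id)) ≈ₘ upperBlock (A ⊗ P σ) B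
upperBlock-⊗-P {d} {e} A B σ i j =
  trans (⊗-P (upperBlock A B) (σ ⊕id) i j) (entries (blockIndex i) (blockIndex j))
  where
  entries : ∀ {i j} → BlockIndex d e i → BlockIndex d e j →
            upperBlock A B i ((σ ⊕id) ⟨$⟩ʳ j) ≡ upperBlock (A ⊗ P σ) B i j
  entries (upper i) (upper j) = trans (cong (upperBlock A B (i ↑ˡ e)) (⊕id-↑ˡ σ j))
    (trans (block-↖ A B _ _ i _) (trans (sym (⊗-P A σ i j)) (sym (block-↖ _ B _ _ i j))))
  entries (upper i) (lower s) = trans (cong (upperBlock A B (i ↑ˡ e)) (⊕id-↑ʳ σ s))
    (trans (block-↗ A B _ _ i s) (sym (block-↗ _ B _ _ i s)))
  entries (lower r) (upper j) = trans (cong (upperBlock A B (d ↑ʳ r)) (⊕id-↑ˡ σ j))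
    (trans (block-↙ A B _ _ r _) (sym (block-↙ _ B _ _ r j)))
  entries (lower r) (lower s) = trans (cong (upperBlock A B (d ↑ʳ r)) (⊕id-↑ʳ σ s))
    (trans (block-↘ A B _ _ r s) (sym (block-↘ _ B _ _ r s)))

≃UP-upperBlock⁺ : ∀ {d e} {A₁ B₁ : Mat d d} (A₂ B₂ : Mat d e) →
                  A₁ ≃UP B₁ → upperBlock A₁ A₂ ≃UP upperBlock B₁ B₂
≃UP-upperBlock⁺ {d} {e} {A₁} {B₁} A₂ B₂ (U , σ , U-unimodular , U⊗A₁≈B₁⊗Pσ) =
  upperBlock U X , σ ⊕id , upperBlock-unimodular X U-unimodular , λ i j → begin
    (upperBlock U X ⊗ upperBlock A₁ A₂) i j                  ≡⟨ upperBlock-⊗-upperBlock U X A₁ A₂ i j ⟩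
    upperBlock (U ⊗ A₁) (λ i s → (U ⊗ A₂) i s +ℤ X i s) i j  ≡⟨ upperBlock-cong U⊗A₁≈B₁⊗Pσ telescope i j ⟩
    upperBlock (B₁ ⊗ P σ) B₂ i j                             ≡⟨ upperBlock-⊗-P B₁ B₂ σ i j ⟨
    (upperBlock B₁ B₂ ⊗ P (σ ⊕id)) i j                       ∎
  where
  open ≡-Reasoning
  X : Mat d e
  X i s = B₂ i s - (U ⊗ A₂) i s
  telescope : ∀ i s → (U ⊗ A₂) i s +ℤ X i s ≡ B₂ i s
  telescope i s = solve 2 (λ x y → x :+ (y :- x) := y) refl ((U ⊗ A₂) i s) (B₂ i s)

module _ {d e} (π : Permutation′ (d + e)) (fixes-lower : ∀ s → π ⟨$⟩ʳ (d ↑ʳ s) ≡ d ↑ʳ s) where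

  preserves-upper : ∀ i → Σ[ j ∈ Fin d ] π ⟨$⟩ʳ (i ↑ˡ e) ≡ j ↑ˡ e
  preserves-upper i with π ⟨$⟩ʳ (i ↑ˡ e) in πi≡x
  ... | x with blockIndex {d} {e} x
  ...   | upper j = j , refl
  ...   | lower s = ⊥-elim (↑ˡ≢↑ʳ i s (begin
    i ↑ˡ e                    ≡⟨ inverseˡ π ⟨
    π ⟨$⟩ˡ (π ⟨$⟩ʳ (i ↑ˡ e))  ≡⟨ cong (π ⟨$⟩ˡ_) (trans πi≡x (sym (fixes-lower s))) ⟩
    π ⟨$⟩ˡ (π ⟨$⟩ʳ (d ↑ʳ s))  ≡⟨ inverseˡ π ⟩
    d ↑ʳ s                    ∎))
    where open ≡-Reasoning

restrictUpper : ∀ {d e} (τ : Permutation′ (d + e)) → (∀ s → τ ⟨$⟩ʳ (d ↑ʳ s) ≡ d ↑ʳ s) →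
                Σ[ τ₁ ∈ Permutation′ d ] (∀ i → τ ⟨$⟩ʳ (i ↑ˡ e) ≡ (τ₁ ⟨$⟩ʳ i) ↑ˡ e)
restrictUpper {d} {e} τ fixes-lower = permutation f g f∘g g∘f , proj₂ ∘ image
  where
  fixes-lower⁻¹ : ∀ s → τ ⟨$⟩ˡ (d ↑ʳ s) ≡ d ↑ʳ s
  fixes-lower⁻¹ s = trans (cong (τ ⟨$⟩ˡ_) (sym (fixes-lower s))) (inverseˡ τ)
  image : ∀ i → Σ[ j ∈ Fin d ] τ ⟨$⟩ʳ (i ↑ˡ e) ≡ j ↑ˡ e
  image = preserves-upper τ fixes-lower
  preimage : ∀ i → Σ[ j ∈ Fin d ] τ ⟨$⟩ˡ (i ↑ˡ e) ≡ j ↑ˡ e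
  preimage = preserves-upper (flip τ) fixes-lower⁻¹
  f g : Fin d → Fin d
  f = proj₁ ∘ image
  g = proj₁ ∘ preimage
  f∘g : ∀ i → f (g i) ≡ i
  f∘g i = ↑ˡ-injective e _ _
    (trans (sym (proj₂ (image (g i)))) (trans (cong (τ ⟨$⟩ʳ_) (sym (proj₂ (preimage i)))) (inverseʳ τ)))
  g∘f : ∀ i → g (f i) ≡ i
  g∘f i = ↑ˡ-injective e _ _
    (trans (sym (proj₂ (preimage (f i)))) (trans (cong (τ ⟨$⟩ˡ_) (sym (proj₂ (image i)))) (inverseˡ τ)))

lowerIndices : ∀ d e → List (Fin (d + e))
lowerIndices d e = tabulate (d ↑ʳ_)

lowerIndices-unitRow : ∀ {d e} (A : Mat d d) (B : Mat d e) {k} →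
                       k ∈ lowerIndices d e → UnitRow (upperBlock A B) k
lowerIndices-unitRow A B k∈ with ∈-tabulate⁻ k∈
... | s , refl = upperBlock-unitRow A B s

module _ {d e} {A₁ B₁ : Mat d d} {A₂ B₂ : Mat d e} where
  open Normalisation (upperBlock A₁ A₂) (upperBlock B₁ B₂)

  upperLeft-≃UP : Normalised (lowerIndices d e) → A₁ ≃UP B₁
  upperLeft-≃UP W = upperLeft U , τ₁ , (upperLeft V , upper-U⊗V≈I , upper-V⊗U≈I) , upper-U⊗A₁≈B₁⊗Pτ₁
    where
    open Normalised W
    V : Mat (d + e) (d + e)
    V = proj₁ U-unimodular
    U⊗V≈I : (U ⊗ V) ≈ₘ I (d + e)
    U⊗V≈I = proj₁ (proj₂ U-unimodular)
    V⊗U≈I : (V ⊗ U) ≈ₘ I (d + e)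
    V⊗U≈I = proj₂ (proj₂ U-unimodular)
    U-lower : ∀ s → UnitRow U (d ↑ʳ s)
    U-lower s = U-unitRow (∈-tabulate⁺ s)
    V-lower : ∀ s → UnitRow V (d ↑ʳ s)
    V-lower s j = trans (sym (unitRow-⊗ U (U-lower s) V j)) (U⊗V≈I _ j)
    lowerLeft≡0 : ∀ M → (∀ s → UnitRow M (d ↑ʳ s)) → ∀ s j → M (d ↑ʳ s) (j ↑ˡ e) ≡ 0ℤ
    lowerLeft≡0 M M-lower s j = trans (M-lower s (j ↑ˡ e)) (I-↙ s j)
    τ-restriction : Σ[ τ₁ ∈ Permutation′ d ] (∀ i → τ ⟨$⟩ʳ (i ↑ˡ e) ≡ (τ₁ ⟨$⟩ʳ i) ↑ˡ e)
    τ-restriction = restrictUpper τ (λ s → τ-fixes (∈-tabulate⁺ s))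
    τ₁ : Permutation′ d
    τ₁ = proj₁ τ-restriction
    upper-U⊗V≈I : (upperLeft U ⊗ upperLeft V) ≈ₘ I d
    upper-U⊗V≈I i j = trans (sym (upperLeft-⊗ U V (lowerLeft≡0 V V-lower) i j)) (trans (U⊗V≈I _ _) (I-↖ i j))
    upper-V⊗U≈I : (upperLeft V ⊗ upperLeft U) ≈ₘ I d
    upper-V⊗U≈I i j = trans (sym (upperLeft-⊗ V U (lowerLeft≡0 U U-lower) i j)) (trans (V⊗U≈I _ _) (I-↖ i j))
    upper-U⊗A₁≈B₁⊗Pτ₁ : (upperLeft U ⊗ A₁) ≈ₘ (B₁ ⊗ P τ₁)
    upper-U⊗A₁≈B₁⊗Pτ₁ i j = begin
      (upperLeft U ⊗ A₁) i j
        ≡⟨ ⊗-congʳ (upperLeft U) (block-↖ A₁ A₂ _ _) i j ⟨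
      (upperLeft U ⊗ upperLeft (upperBlock A₁ A₂)) i j
        ≡⟨ upperLeft-⊗ U (upperBlock A₁ A₂) (block-↙ A₁ A₂ _ _) i j ⟨
      (U ⊗ upperBlock A₁ A₂) (i ↑ˡ e) (j ↑ˡ e)
        ≡⟨ U⊗C≡Dτ _ _ ⟩
      upperBlock B₁ B₂ (i ↑ˡ e) (τ ⟨$⟩ʳ (j ↑ˡ e))
        ≡⟨ cong (upperBlock B₁ B₂ (i ↑ˡ e)) (proj₂ τ-restriction j) ⟩
      upperBlock B₁ B₂ (i ↑ˡ e) ((τ₁ ⟨$⟩ʳ j) ↑ˡ e)
        ≡⟨ block-↖ B₁ B₂ _ _ i _ ⟩
      B₁ i (τ₁ ⟨$⟩ʳ j)
        ≡⟨ ⊗-P B₁ τ₁ i j ⟨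
      (B₁ ⊗ P τ₁) i j
        ∎
      where open ≡-Reasoning

  ≃UP-upperBlock⁻ : upperBlock A₁ A₂ ≃UP upperBlock B₁ B₂ → A₁ ≃UP B₁
  ≃UP-upperBlock⁻ =
    upperLeft-≃UP ∘ normalise (lowerIndices d e) (lowerIndices-unitRow A₁ A₂) (lowerIndices-unitRow B₁ B₂)

proposition2p8 : (d e : ℕ) (A₁ B₁ : Mat d d) (A₂ B₂ : Mat d (suc e)) →
    ((A₁ ≃UP B₁) → (block A₁ A₂ (zeroMat (suc e) d) (I (suc e)) ≃UP block B₁ B₂ (zeroMat (suc e) d) (I (suc e))))
    × ((block A₁ A₂ (zeroMat (suc e) d) (I (suc e)) ≃UP block B₁ B₂ (zeroMat (suc e) d) (I (suc e))) → (A₁ ≃UP B₁))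
proposition2p8 d e A₁ B₁ A₂ B₂ = ≃UP-upperBlock⁺ A₂ B₂ , ≃UP-upperBlock⁻
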